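{- For every positive integer $k$, $H(k)\le p_{\pi(2k)+k}^2-p_{\pi(2k)+1}^2$.
   Context: A set of $k$ integers $\mathcal{H}$ is strongly admissible if for every even integer $N$ and every prime $p$, the set $\mathcal{H}\cup(\mathcal{H}-N)$ meets fewer than $p$ residue classes modulo $p$. $H(k)$ denotes the minimum of $\max_{h,h'\in\mathcal{H}}(h-h')$ over strongly admissible sets $\mathcal{H}$ of $k$ integers. $p_i$ is the $i$-th prime and $\pi(x)$ the number of primes $\le x$. -}

module Defs where

open import Data.Nat as ℕ using (ℕ; suc; _<_)
open import Data.Nat.Primality using (Prime; prime?; prime⇒nonZero)
open import Data.Integer as ℤ using (ℤ; +_; _-_)
open import Data.Integer.DivMod using (_%ℕ_)
open import Data.Integer.Divisibility using (_∣_)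
open import Data.List using (List; length; filter; upTo; map; _++_)
open import Data.List.Relation.Unary.Any using (any?)
open import Data.List.Relation.Unary.Unique.Propositional using (Unique)
open import Data.List.Membership.Propositional using (_∈_)
open import Data.Product using (Σ; _×_)
open import Relation.Binary.PropositionalEquality using (_≡_)

residue : (p : ℕ) → Prime p → ℤ → ℕ
residue p pp x = let instance _ = prime⇒nonZero pp in x %ℕ p

numClasses : (p : ℕ) → Prime p → List ℤ → ℕ
numClasses p pp L =
  length (filter (λ r → any? (λ x → residue p pp x ℕ.≟ r) L) (upTo p))

StronglyAdmissible : List ℤ → Set
StronglyAdmissible H =
  (N : ℤ) → (+ 2) ∣ N → (p : ℕ) → (pp : Prime p) →
  numClasses p pp (H ++ map (λ h → h - N) H) < p

primeCount : ℕ → ℕ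
primeCount x = length (filter prime? (upTo (suc x)))

-- q is the i-th prime p_i (p_1 = 2)
IsNthPrime : ℕ → ℕ → Set
IsNthPrime i q = Prime q × primeCount q ≡ i

-- H(k) ≤ X : some strongly admissible set of k (distinct) integers has
-- diameter max_{h,h'} (h - h') at most X
HAtMost : ℕ → ℤ → Set
HAtMost k X = Σ (List ℤ) λ H →
  Unique H × length H ≡ k × StronglyAdmissible H ×
  (∀ {h h'} → h ∈ H → h' ∈ H → h - h' ℤ.≤ X)

{-# OPTIONS --safe #-}
module Submission where

-- Take H = {q² : q prime, 2k < q ≤ a}; by the choice of a and b these q are the k primes
-- b = p_{π(2k)+1}, …, p_{π(2k)+k} = a, so the diameter of H is at most a² − b².
-- For an even N and a prime p > 2k, the 2k elements of H ∪ (H − N) cannot meet all p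
-- classes. A prime p ≤ 2k divides no such q: for p = 2 every q² and q² − N is odd, and for
-- p = 2h + 1 every q² is congruent to one of 1², …, h², so H ∪ (H − N) meets at most
-- 2h < p classes.

open import Defs
open import Data.Nat as ℕ
  using (ℕ; zero; suc; _+_; _*_; _∸_; _≤_; _<_; _⊔_; z≤n; s≤s; NonZero; _<?_; _≟_)
open import Data.Nat.Properties as ℕ using ()
open import Data.Nat.DivMod
  using (_%_; _/_; m%n<n; m≡m%n+[m/n]*n; [m+kn]%n≡m%n; %-distribˡ-*)
open import Data.Nat.Divisibility as ℕ using (_∤_; >⇒∤; m%n≡0⇒n∣m)
open import Data.Nat.Primality
  using (Prime; prime?; prime[2]; prime⇒irreducible; ¬prime[1]; prime⇒nonZero)
import Data.Nat.Tactic.RingSolver as ℕ-Solver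
open import Data.Integer as ℤ using (ℤ; +_; _-_)
open import Data.Integer.DivMod using (_%ℕ_; _/ℕ_; a≡a%ℕn+[a/ℕn]*n; n%ℕd<d)
open import Data.Integer.Divisibility.Signed
  using (_∣_; divides; ∣-refl; ∣m+n∣n⇒∣m; ∣n⇒∣m*n; ∣m⇒∣-m; ∣⇒∣ᵤ; ∣ᵤ⇒∣)
open import Data.Integer.Properties as ℤ using ()
import Data.Integer.Tactic.RingSolver as ℤ-Solver
open import Data.List
  using (List; []; _∷_; [_]; _++_; length; map; filter; upTo; applyUpTo)
open import Data.List.Properties
  using (length-++; length-map; length-applyUpTo; filter-++; filter-accept; upTo-∷ʳ)
open import Data.List.Membership.Propositional using (_∈_; find)
open import Data.List.Membership.Propositional.Properties
  using (∈-∃++; ∈-++⁻; ∈-++⁺ˡ; ∈-++⁺ʳ; ∈-map⁺; ∈-map⁻; ∈-filter⁻; ∈-applyUpTo⁺; ∈-applyUpTo⁻)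
open import Data.List.Relation.Binary.Subset.Propositional using (_⊆_)
open import Data.List.Relation.Unary.All as All using ()
open import Data.List.Relation.Unary.Any using (here; there; any?)
open import Data.List.Relation.Unary.AllPairs using (_∷_)
open import Data.List.Relation.Unary.Unique.Propositional using (Unique)
open import Data.List.Relation.Unary.Unique.Propositional.Properties
  using (filter⁺; upTo⁺; map⁺; applyUpTo⁺₁)
open import Data.Product using (∃-syntax; _×_; _,_; proj₁; proj₂)
open import Data.Sum using (inj₁; inj₂; [_,_]′)
open import Function using (_∘_)
open import Relation.Binary.PropositionalEquality
  using (_≡_; _≢_; refl; sym; trans; cong; cong₂; subst; module ≡-Reasoning)
open import Relation.Binary.Definitions using (tri<; tri≈; tri>)
open import Relation.Nullary using (yes; no; contradiction)

private
  variable
    A : Set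
    m n p q : ℕ

applyUpTo-+ : ∀ (f : ℕ → A) m n →
              applyUpTo f (m + n) ≡ applyUpTo f m ++ applyUpTo (λ i → f (m + i)) n
applyUpTo-+ f zero    n = refl
applyUpTo-+ f (suc m) n = cong (f 0 ∷_) (applyUpTo-+ (f ∘ suc) m n)

Unique-⊆⇒length-≤ : ∀ {xs ys : List A} → Unique xs → xs ⊆ ys → length xs ≤ length ys
Unique-⊆⇒length-≤ {xs = []}     _                   _       = z≤n
Unique-⊆⇒length-≤ {xs = x ∷ xs} (x∉xs ∷ xs-unique) x∷xs⊆ys
  with ys₁ , ys₂ , refl ← ∈-∃++ (x∷xs⊆ys (here refl)) = begin
    suc (length xs)               ≤⟨ s≤s (Unique-⊆⇒length-≤ xs-unique xs⊆ys₁++ys₂) ⟩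
    suc (length (ys₁ ++ ys₂))     ≡⟨ cong suc (length-++ ys₁) ⟩
    suc (length ys₁ + length ys₂) ≡⟨ ℕ.+-suc (length ys₁) (length ys₂) ⟨
    length ys₁ + length (x ∷ ys₂) ≡⟨ length-++ ys₁ ⟨
    length (ys₁ ++ x ∷ ys₂)       ∎
  where
  open ℕ.≤-Reasoning
  xs⊆ys₁++ys₂ : xs ⊆ ys₁ ++ ys₂
  xs⊆ys₁++ys₂ {z} z∈xs with ∈-++⁻ ys₁ (x∷xs⊆ys (there z∈xs))
  ... | inj₁ z∈ys₁         = ∈-++⁺ˡ z∈ys₁
  ... | inj₂ (here z≡x)    = contradiction (sym z≡x) (All.lookup x∉xs z∈xs)
  ... | inj₂ (there z∈ys₂) = ∈-++⁺ʳ ys₁ z∈ys₂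

-- The primes q with m < q ≤ n; truncated subtraction makes this empty when n ≤ m.
primesBetween : ℕ → ℕ → List ℕ
primesBetween m n = filter prime? (applyUpTo (λ i → suc (m + i)) (n ∸ m))

∈-primesBetween⁻ : ∀ m n → q ∈ primesBetween m n → Prime q × m < q × q ≤ n
∈-primesBetween⁻ {q} m n q∈
  with q∈range , q-prime ← ∈-filter⁻ prime? {xs = applyUpTo (λ i → suc (m + i)) (n ∸ m)} q∈
  with i , i<n∸m , refl ← ∈-applyUpTo⁻ (λ i → suc (m + i)) q∈range =
  q-prime , s≤s (ℕ.m≤m+n m i) , subst (suc (m + i) ≤_) (ℕ.m+[n∸m]≡n m≤n) (ℕ.+-monoʳ-< m i<n∸m)
  where
  m≤n : m ≤ n
  m≤n = ℕ.≮⇒≥ λ n<m → contradiction (subst (i <_) (ℕ.m≤n⇒m∸n≡0 (ℕ.<⇒≤ n<m)) i<n∸m) λ ()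

primesBetween-unique : ∀ m n → Unique (primesBetween m n)
primesBetween-unique m n =
  filter⁺ prime? (applyUpTo⁺₁ _ (n ∸ m) λ i<j _ → ℕ.<⇒≢ (s≤s (ℕ.+-monoʳ-< m i<j)))

primeCount-split : m ≤ n → primeCount n ≡ primeCount m + length (primesBetween m n)
primeCount-split {m} {n} m≤n = begin
  primeCount n
    ≡⟨ cong primeCount (ℕ.m+[n∸m]≡n m≤n) ⟨
  length (filter prime? (upTo (suc m + (n ∸ m))))
    ≡⟨ cong (length ∘ filter prime?) (applyUpTo-+ (λ i → i) (suc m) (n ∸ m)) ⟩
  length (filter prime? (upTo (suc m) ++ range))
    ≡⟨ cong length (filter-++ prime? (upTo (suc m)) range) ⟩
  length (filter prime? (upTo (suc m)) ++ filter prime? range)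
    ≡⟨ length-++ (filter prime? (upTo (suc m))) ⟩
  primeCount m + length (primesBetween m n)
    ∎
  where
  open ≡-Reasoning
  range = applyUpTo (λ i → suc (m + i)) (n ∸ m)

primeCount-suc-prime : Prime (suc n) → primeCount (suc n) ≡ suc (primeCount n)
primeCount-suc-prime {n} sn-prime = begin
  length (filter prime? (upTo (suc (suc n))))
    ≡⟨ cong (length ∘ filter prime?) (upTo-∷ʳ (suc n)) ⟨
  length (filter prime? (upTo (suc n) ++ [ suc n ]))
    ≡⟨ cong length (filter-++ prime? (upTo (suc n)) [ suc n ]) ⟩
  length (primes≤n ++ filter prime? [ suc n ])
    ≡⟨ cong (λ l → length (primes≤n ++ l)) (filter-accept prime? sn-prime) ⟩
  length (primes≤n ++ [ suc n ])
    ≡⟨ length-++ primes≤n ⟩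
  primeCount n + 1
    ≡⟨ ℕ.+-comm (primeCount n) 1 ⟩
  suc (primeCount n)
    ∎
  where
  open ≡-Reasoning
  primes≤n = filter prime? (upTo (suc n))

primeCount-mono-≤ : m ≤ n → primeCount m ≤ primeCount n
primeCount-mono-≤ {m} m≤n =
  subst (primeCount m ≤_) (sym (primeCount-split m≤n)) (ℕ.m≤m+n (primeCount m) _)

primeCount-mono-< : m < n → Prime n → primeCount m < primeCount n
primeCount-mono-< {m} {suc n} (s≤s m≤n) n-prime =
  subst (primeCount m <_) (sym (primeCount-suc-prime n-prime)) (s≤s (primeCount-mono-≤ m≤n))

primeCount-<⇒< : primeCount m < primeCount n → m < n
primeCount-<⇒< πm<πn = ℕ.≰⇒> λ n≤m → ℕ.<⇒≱ πm<πn (primeCount-mono-≤ n≤m)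

primeCount-≤⇒≤ : Prime m → primeCount m ≤ primeCount n → m ≤ n
primeCount-≤⇒≤ m-prime πm≤πn = ℕ.≮⇒≥ λ n<m → ℕ.<⇒≱ (primeCount-mono-< n<m m-prime) πm≤πn

firstPrimeAbove-≤ : ∀ {b} → IsNthPrime (primeCount m + 1) b → m < q → Prime q → b ≤ q
firstPrimeAbove-≤ {m} {q} (b-prime , πb≡πm+1) m<q q-prime =
  primeCount-≤⇒≤ b-prime (subst (_≤ primeCount q) 1+πm≡πb (primeCount-mono-< m<q q-prime))
  where
  1+πm≡πb = trans (ℕ.+-comm 1 (primeCount m)) (sym πb≡πm+1)

∣∧<⇒≡0 : m ℕ.∣ n → n < m → n ≡ 0
∣∧<⇒≡0 {n = zero}  _   _   = refl
∣∧<⇒≡0 {n = suc _} m∣n n<m = contradiction m∣n (>⇒∤ n<m)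

module _ {p : ℕ} .{{_ : NonZero p}} where

  private
    divMod-diff : ∀ x y → x - y ≡ (+ (x %ℕ p) - + (y %ℕ p)) ℤ.+ (x /ℕ p - y /ℕ p) ℤ.* + p
    divMod-diff x y = trans (cong₂ _-_ (a≡a%ℕn+[a/ℕn]*n x p) (a≡a%ℕn+[a/ℕn]*n y p))
                            (regroup (+ (x %ℕ p)) (+ (y %ℕ p)) (x /ℕ p) (y /ℕ p) (+ p))
      where
      regroup : ∀ (r s X Y P : ℤ) → (r ℤ.+ X ℤ.* P) - (s ℤ.+ Y ℤ.* P) ≡ (r - s) ℤ.+ (X - Y) ℤ.* P
      regroup = ℤ-Solver.solve-∀

  %ℕ-≡⇒∣ : ∀ x y → x %ℕ p ≡ y %ℕ p → + p ∣ x - y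
  %ℕ-≡⇒∣ x y eq = divides (x /ℕ p - y /ℕ p) (begin
    x - y                                  ≡⟨ divMod-diff x y ⟩
    (+ (x %ℕ p) - + (y %ℕ p)) ℤ.+ multiple ≡⟨ cong (ℤ._+ multiple) (ℤ.i≡j⇒i-j≡0 (cong +_ eq)) ⟩
    ℤ.0ℤ ℤ.+ multiple                       ≡⟨ ℤ.+-identityˡ multiple ⟩
    multiple                               ∎)
    where
    open ≡-Reasoning
    multiple = (x /ℕ p - y /ℕ p) ℤ.* + p

  -- The two remainders differ by a multiple of p of absolute value less than p.
  ∣⇒%ℕ-≡ : ∀ x y → + p ∣ x - y → x %ℕ p ≡ y %ℕ p
  ∣⇒%ℕ-≡ x y p∣x-y =
    ℤ.+-injective (ℤ.i-j≡0⇒i≡j (+ r) (+ s) (ℤ.∣i∣≡0⇒i≡0 (∣∧<⇒≡0 (∣⇒∣ᵤ p∣r-s) ∣r-s∣<p)))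
    where
    r = x %ℕ p
    s = y %ℕ p
    p∣r-s : + p ∣ + r - + s
    p∣r-s = ∣m+n∣n⇒∣m (subst (+ p ∣_) (divMod-diff x y) p∣x-y) (∣n⇒∣m*n (x /ℕ p - y /ℕ p) ∣-refl)
    ∣r-s∣<p : ℤ.∣ + r - + s ∣ < p
    ∣r-s∣<p = begin-strict
      ℤ.∣ + r - + s ∣  ≡⟨ cong ℤ.∣_∣ (ℤ.m-n≡m⊖n r s) ⟩
      ℤ.∣ r ℤ.⊖ s ∣    ≤⟨ ℤ.∣m⊝n∣≤m⊔n r s ⟩
      r ⊔ s            <⟨ ℕ.⊔-lub (n%ℕd<d x p) (n%ℕd<d y p) ⟩
      p                ∎
      where open ℕ.≤-Reasoning

  [i-k]%ℕ≡[j-k]%ℕ : ∀ {i j} k → i %ℕ p ≡ j %ℕ p → (i - k) %ℕ p ≡ (j - k) %ℕ p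
  [i-k]%ℕ≡[j-k]%ℕ {i} {j} k eq =
    ∣⇒%ℕ-≡ (i - k) (j - k) (subst (+ p ∣_) (sym (cancel i j k)) (%ℕ-≡⇒∣ i j eq))
    where
    cancel : ∀ (x y z : ℤ) → (x - z) - (y - z) ≡ x - y
    cancel = ℤ-Solver.solve-∀

  [i-k]%ℕ≡i%ℕ : ∀ i {k} → + p ∣ k → (i - k) %ℕ p ≡ i %ℕ p
  [i-k]%ℕ≡i%ℕ i {k} p∣k =
    ∣⇒%ℕ-≡ (i - k) i (subst (+ p ∣_) (sym (cancel i k)) (∣m⇒∣-m p∣k))
    where
    cancel : ∀ (x z : ℤ) → (x - z) - x ≡ ℤ.- z
    cancel = ℤ-Solver.solve-∀

square : ℕ → ℤ
square q = + (q * q)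

square-injective : square m ≡ square n → m ≡ n
square-injective {m} {n} eq with ℕ.<-cmp m n
... | tri< m<n _ _ = contradiction (ℤ.+-injective eq) (ℕ.<⇒≢ (ℕ.*-mono-< m<n m<n))
... | tri≈ _ m≡n _ = m≡n
... | tri> _ _ n<m = contradiction (ℤ.+-injective eq) (ℕ.>⇒≢ (ℕ.*-mono-< n<m n<m))

square-diff-≤ : ∀ {a b q q'} → q ≤ a → b ≤ q' → square q - square q' ℤ.≤ square a - square b
square-diff-≤ q≤a b≤q' =
  ℤ.+-mono-≤ (ℤ.+≤+ (ℕ.*-mono-≤ q≤a q≤a)) (ℤ.neg-mono-≤ (ℤ.+≤+ (ℕ.*-mono-≤ b≤q' b≤q')))

m%2≢0⇒m%2≡1 : ∀ m → m % 2 ≢ 0 → m % 2 ≡ 1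
m%2≢0⇒m%2≡1 m m%2≢0 with m % 2 | m%n<n m 2
... | zero        | _             = contradiction refl m%2≢0
... | suc zero    | _             = refl
... | suc (suc _) | s≤s (s≤s ())

prime∣prime⇒≡ : Prime p → Prime q → p ℕ.∣ q → p ≡ q
prime∣prime⇒≡ p-prime q-prime p∣q with prime⇒irreducible q-prime p∣q
... | inj₁ refl = contradiction p-prime ¬prime[1]
... | inj₂ p≡q  = p≡q

prime≢2⇒odd : Prime p → p ≢ 2 → p ≡ suc (p / 2 + p / 2)
prime≢2⇒odd {p} p-prime p≢2 = begin
  p                         ≡⟨ m≡m%n+[m/n]*n p 2 ⟩
  p % 2 + p / 2 * 2         ≡⟨ cong (_+ p / 2 * 2) (m%2≢0⇒m%2≡1 p 2∤p) ⟩
  1 + p / 2 * 2             ≡⟨ cong suc (ℕ.*-comm (p / 2) 2) ⟩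
  suc (p / 2 + (p / 2 + 0)) ≡⟨ cong (λ h → suc (p / 2 + h)) (ℕ.+-identityʳ (p / 2)) ⟩
  suc (p / 2 + p / 2)       ∎
  where
  open ≡-Reasoning
  2∤p : p % 2 ≢ 0
  2∤p p%2≡0 = p≢2 (sym (prime∣prime⇒≡ prime[2] p-prime (m%n≡0⇒n∣m p 2 p%2≡0)))

square%2≡1 : ∀ q → q % 2 ≢ 0 → (q * q) % 2 ≡ 1
square%2≡1 q q%2≢0 = begin
  (q * q) % 2             ≡⟨ %-distribˡ-* q q 2 ⟩
  ((q % 2) * (q % 2)) % 2 ≡⟨ cong (λ r → (r * r) % 2) (m%2≢0⇒m%2≡1 q q%2≢0) ⟩
  1                       ∎
  where open ≡-Reasoning

[n∸m]*[n∸m]%n≡m*m%n : ∀ {m n} .{{_ : NonZero n}} → m ≤ n →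
                      ((n ∸ m) * (n ∸ m)) % n ≡ (m * m) % n
[n∸m]*[n∸m]%n≡m*m%n {m} {n} m≤n = begin
  (j * j) % n               ≡⟨ [m+kn]%n≡m%n (j * j) m n ⟨
  (j * j + m * n) % n       ≡⟨ cong (λ k → (j * j + m * k) % n) j+m≡n ⟨
  (j * j + m * (j + m)) % n ≡⟨ cong (_% n) (swap j m) ⟩
  (m * m + j * (j + m)) % n ≡⟨ cong (λ k → (m * m + j * k) % n) j+m≡n ⟩
  (m * m + j * n) % n       ≡⟨ [m+kn]%n≡m%n (m * m) j n ⟩
  (m * m) % n               ∎
  where
  open ≡-Reasoning
  j = n ∸ m
  j+m≡n : j + m ≡ n
  j+m≡n = ℕ.m∸n+n≡m m≤n
  swap : ∀ a b → a * a + b * (a + b) ≡ b * b + a * (a + b)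
  swap = ℕ-Solver.solve-∀

-- (p − r)² ≡ r², so r = q mod p can be replaced by p − r when r > h.
square%≡small-square% : ∀ {p h} .{{_ : NonZero p}} → p ≡ suc (h + h) → ∀ q → p ∤ q →
                        ∃[ j ] 0 < j × j ≤ h × (q * q) % p ≡ (j * j) % p
square%≡small-square% {p} {h} p≡2h+1 q p∤q =
  [ (λ r≤h → r , 0<r , r≤h , q²≡r²)
  , (λ h<r → p ∸ r , ℕ.m<n⇒0<n∸m r<p , p∸r≤h h<r ,
             trans q²≡r² (sym ([n∸m]*[n∸m]%n≡m*m%n (ℕ.<⇒≤ r<p))))
  ]′ (ℕ.≤-<-connex r h)
  where
  r = q % p
  r<p : r < p
  r<p = m%n<n q p
  0<r : 0 < r
  0<r = ℕ.n≢0⇒n>0 (p∤q ∘ m%n≡0⇒n∣m q p)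
  q²≡r² : (q * q) % p ≡ (r * r) % p
  q²≡r² = %-distribˡ-* q q p
  p∸r≤h : h < r → p ∸ r ≤ h
  p∸r≤h h<r = ℕ.≤-trans (ℕ.∸-monoʳ-≤ p h<r)
    (ℕ.≤-reflexive (subst (λ n → n ∸ suc h ≡ h) (sym p≡2h+1) (ℕ.m+n∸m≡n h h)))

unionShift : ℤ → List ℤ → List ℤ
unionShift N H = H ++ map (λ h → h - N) H

length-unionShift : ∀ N H → length (unionShift N H) ≡ 2 * length H
length-unionShift N H = begin
  length (H ++ map (λ h → h - N) H)       ≡⟨ length-++ H ⟩
  length H + length (map (λ h → h - N) H) ≡⟨ cong (length H ℕ.+_) (length-map (λ h → h - N) H) ⟩
  length H + length H                     ≡⟨ cong (length H ℕ.+_) (ℕ.+-identityʳ (length H)) ⟨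
  2 * length H                            ∎
  where open ≡-Reasoning

module _ (p : ℕ) (p-prime : Prime p) where

  numClasses-≤ : ∀ L ys → (∀ {x} → x ∈ L → residue p p-prime x ∈ ys) →
                 numClasses p p-prime L ≤ length ys
  numClasses-≤ L ys residue∈ys = Unique-⊆⇒length-≤ (filter⁺ meets? (upTo⁺ p)) classes⊆ys
    where
    meets? = λ r → any? (λ x → residue p p-prime x ≟ r) L
    classes⊆ys : filter meets? (upTo p) ⊆ ys
    classes⊆ys r∈ with x , x∈L , refl ← find (proj₂ (∈-filter⁻ meets? {xs = upTo p} r∈)) =
      residue∈ys x∈L

  numClasses-≤-length : ∀ L → numClasses p p-prime L ≤ length L
  numClasses-≤-length L = subst (numClasses p p-prime L ≤_) (length-map (residue p p-prime) L)
    (numClasses-≤ L (map (residue p p-prime) L) (∈-map⁺ (residue p p-prime)))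

  numClasses-unionShift-≤ : ∀ N H ys →
    (∀ {h} → h ∈ H → residue p p-prime h ∈ ys × residue p p-prime (h - N) ∈ ys) →
    numClasses p p-prime (unionShift N H) ≤ length ys
  numClasses-unionShift-≤ N H ys residues∈ys = numClasses-≤ (unionShift N H) ys residue∈ys
    where
    residue∈ys : ∀ {x} → x ∈ unionShift N H → residue p p-prime x ∈ ys
    residue∈ys x∈ with ∈-++⁻ H x∈
    ... | inj₁ x∈H   = proj₁ (residues∈ys x∈H)
    ... | inj₂ x∈H-N with h , h∈H , refl ← ∈-map⁻ (λ h → h - N) x∈H-N = proj₂ (residues∈ys h∈H)

numClasses-squares-<-2 : ∀ {N} → + 2 ∣ N → ∀ Q → (∀ {q} → q ∈ Q → 2 ∤ q) →
                         numClasses 2 prime[2] (unionShift N (map square Q)) < 2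
numClasses-squares-<-2 {N} 2∣N Q 2∤Q =
  s≤s (numClasses-unionShift-≤ 2 prime[2] N (map square Q) [ 1 ] residues≡1)
  where
  residues≡1 : ∀ {h} → h ∈ map square Q → (h %ℕ 2) ∈ [ 1 ] × ((h - N) %ℕ 2) ∈ [ 1 ]
  residues≡1 h∈ with q , q∈Q , refl ← ∈-map⁻ square h∈ =
    here q²%2≡1 , here (trans ([i-k]%ℕ≡i%ℕ (square q) 2∣N) q²%2≡1)
    where
    q²%2≡1 = square%2≡1 q (2∤Q q∈Q ∘ m%n≡0⇒n∣m q 2)

-- Every class met is that of j² or of j² − N for some 1 ≤ j ≤ h, where p = 2h + 1.
numClasses-squares-<-odd : ∀ {p N} (p-prime : Prime p) → p ≢ 2 → ∀ Q → (∀ {q} → q ∈ Q → p ∤ q) →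
                           numClasses p p-prime (unionShift N (map square Q)) < p
numClasses-squares-<-odd {p} {N} p-prime p≢2 Q p∤Q = begin-strict
  numClasses p p-prime (unionShift N (map square Q))
    ≤⟨ numClasses-unionShift-≤ p p-prime N (map square Q) ys residues∈ys ⟩
  length (map res² js ++ map res²-N js)
    ≡⟨ length-++ (map res² js) ⟩
  length (map res² js) + length (map res²-N js)
    ≡⟨ cong₂ _+_ (length-map res² js) (length-map res²-N js) ⟩
  length js + length js
    ≡⟨ cong (λ l → l + l) (length-applyUpTo suc h) ⟩
  h + h
    <⟨ ℕ.≤-reflexive (sym p≡2h+1) ⟩
  p ∎
  where
  open ℕ.≤-Reasoning
  instance _ = prime⇒nonZero p-prime
  h = p / 2
  p≡2h+1 = prime≢2⇒odd p-prime p≢2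
  res² res²-N : ℕ → ℕ
  res² j = residue p p-prime (square j)
  res²-N j = residue p p-prime (square j - N)
  js = applyUpTo suc h
  ys = map res² js ++ map res²-N js
  residues∈ys : ∀ {x} → x ∈ map square Q →
                residue p p-prime x ∈ ys × residue p p-prime (x - N) ∈ ys
  residues∈ys x∈ with q , q∈Q , refl ← ∈-map⁻ square x∈
                 with suc i , _ , i<h , q²≡j² ← square%≡small-square% p≡2h+1 q (p∤Q q∈Q) =
    subst (_∈ ys) (sym q²≡j²) (∈-++⁺ˡ (∈-map⁺ res² i∈js)) ,
    subst (_∈ ys) (sym ([i-k]%ℕ≡[j-k]%ℕ {p} {square q} {square (suc i)} N q²≡j²))
          (∈-++⁺ʳ (map res² js) (∈-map⁺ res²-N i∈js))
    where
    i∈js = ∈-applyUpTo⁺ suc i<h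

numClasses-squares-< : ∀ {p N} (p-prime : Prime p) → + 2 ∣ N → ∀ Q → (∀ {q} → q ∈ Q → p ∤ q) →
                       numClasses p p-prime (unionShift N (map square Q)) < p
numClasses-squares-< {p} p-prime 2∣N Q p∤Q with p ≟ 2
... | yes refl = numClasses-squares-<-2 2∣N Q p∤Q
... | no p≢2   = numClasses-squares-<-odd p-prime p≢2 Q p∤Q

squares-stronglyAdmissible : ∀ Q → (∀ {q} → q ∈ Q → Prime q × 2 * length Q < q) →
                             StronglyAdmissible (map square Q)
squares-stronglyAdmissible Q large N 2∣N p p-prime with 2 * length Q <? p
... | yes 2|Q|<p = ℕ.≤-<-trans (numClasses-≤-length p p-prime (unionShift N (map square Q)))
  (subst (_< p) (sym (trans (length-unionShift N (map square Q)) (cong (2 *_) (length-map square Q))))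
         2|Q|<p)
... | no 2|Q|≮p = numClasses-squares-< p-prime (∣ᵤ⇒∣ 2∣N) Q p∤Q
  where
  p∤Q : ∀ {q} → q ∈ Q → p ∤ q
  p∤Q q∈Q p∣q = ℕ.<⇒≢ (ℕ.≤-<-trans (ℕ.≮⇒≥ 2|Q|≮p) (proj₂ (large q∈Q)))
                      (prime∣prime⇒≡ p-prime (proj₁ (large q∈Q)) p∣q)

lemma5p7 : (k : ℕ) → 1 ≤ k → (a b : ℕ) →
    IsNthPrime (primeCount (2 * k) + k) a →
    IsNthPrime (primeCount (2 * k) + 1) b →
    HAtMost k (+ (a * a) - + (b * b))
lemma5p7 k 1≤k a b (a-prime , πa≡M+k) b-nth =
  map square Q , map⁺ square-injective (primesBetween-unique K a) ,
  trans (length-map square Q) |Q|≡k , squares-stronglyAdmissible Q large , diameter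
  where
  K = 2 * k
  M = primeCount K
  Q = primesBetween K a
  K<a : K < a
  K<a = primeCount-<⇒< (subst (M <_) (sym πa≡M+k) (ℕ.m<m+n M 1≤k))
  |Q|≡k : length Q ≡ k
  |Q|≡k = ℕ.+-cancelˡ-≡ M (length Q) k (trans (sym (primeCount-split (ℕ.<⇒≤ K<a))) πa≡M+k)
  large : ∀ {q} → q ∈ Q → Prime q × 2 * length Q < q
  large q∈Q with q-prime , K<q , _ ← ∈-primesBetween⁻ K a q∈Q =
    q-prime , subst (λ l → 2 * l < _) (sym |Q|≡k) K<q
  b≤Q : ∀ {q} → q ∈ Q → b ≤ q
  b≤Q q∈Q with q-prime , K<q , _ ← ∈-primesBetween⁻ K a q∈Q = firstPrimeAbove-≤ b-nth K<q q-prime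
  Q≤a : ∀ {q} → q ∈ Q → q ≤ a
  Q≤a q∈Q = proj₂ (proj₂ (∈-primesBetween⁻ K a q∈Q))
  diameter : ∀ {h h'} → h ∈ map square Q → h' ∈ map square Q → h - h' ℤ.≤ square a - square b
  diameter h∈ h'∈ with q , q∈Q , refl ← ∈-map⁻ square h∈ | q' , q'∈Q , refl ← ∈-map⁻ square h'∈ =
    square-diff-≤ (Q≤a q∈Q) (b≤Q q'∈Q)
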